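{- Let $C_n$ be the cycle on an odd number $n\geq 3$ of vertices. Then $F_{xt}(C_n)=\lfloor n/2\rfloor$ and the number $\Pi_t$ of fixatic partitions of $V(C_n)$ with $\lfloor n/2\rfloor$ classes equals $$\Pi_t=\frac{1}{(\lfloor n/2\rfloor-1)!}\binom{n}{3}\binom{n-3}{2,2,\ldots,2},$$ where the multinomial coefficient has $\lfloor n/2\rfloor-1$ entries equal to $2$.
   Context: A set $F\subseteq V(G)$ is a fixing set of a graph $G$ if the only automorphism of $G$ fixing every vertex of $F$ is the identity. A fixatic partition of $G$ is a (unordered) partition of $V(G)$ into classes each of which is a fixing set; the fixatic number $F_{xt}(G)$ is the maximum number of classes in a fixatic partition, and $\Pi_t$ denotes the number of fixatic partitions having $F_{xt}(G)$ classes. -}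

module Defs where

open import Data.Nat using (ℕ; zero; suc; _+_; _*_; _∸_; _≤_; _/_; NonZero; _!)
open import Data.Nat.Properties using (_!≢0; m*n≢0)

open import Data.Fin using (Fin; toℕ)
open import Data.Fin.Permutation using (Permutation′; _⟨$⟩ʳ_)
open import Data.Vec using (Vec; lookup)
open import Data.List using (List; []; _∷_; length)
open import Data.List.Relation.Unary.All using (All)
open import Data.List.Relation.Unary.Any using (Any)
open import Data.List.Relation.Unary.AllPairs using (AllPairs)
open import Data.Product using (Σ; ∃; _×_; _,_)
open import Data.Sum using (_⊎_)
open import Relation.Nullary using (¬_)
open import Relation.Binary.PropositionalEquality using (_≡_)

Succ : (n : ℕ) → Fin n → Fin n → Set
Succ n u v = (toℕ v ≡ suc (toℕ u)) ⊎ ((toℕ u ≡ n ∸ 1) × (toℕ v ≡ 0))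

CycleAdj : (n : ℕ) → Fin n → Fin n → Set
CycleAdj n u v = Succ n u v ⊎ Succ n v u

IsAutomorphism : (n : ℕ) → Permutation′ n → Set
IsAutomorphism n σ = ∀ u v →
  (CycleAdj n u v → CycleAdj n (σ ⟨$⟩ʳ u) (σ ⟨$⟩ʳ v)) ×
  (CycleAdj n (σ ⟨$⟩ʳ u) (σ ⟨$⟩ʳ v) → CycleAdj n u v)

IsFixingSet : (n : ℕ) → (Fin n → Set) → Set
IsFixingSet n F = ∀ (σ : Permutation′ n) → IsAutomorphism n σ →
  (∀ v → F v → σ ⟨$⟩ʳ v ≡ v) → ∀ v → σ ⟨$⟩ʳ v ≡ v

-- A partition of V(C_n) into k (nonempty) classes, given by a labelling
-- c : vertices → Fin k that is surjective; class j = {v | c v = j}.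
IsPartition : (n k : ℕ) → Vec (Fin k) n → Set
IsPartition n k c = ∀ (j : Fin k) → ∃ λ v → lookup c v ≡ j

IsFixaticPartition : (n k : ℕ) → Vec (Fin k) n → Set
IsFixaticPartition n k c =
  IsPartition n k c × (∀ (j : Fin k) → IsFixingSet n (λ v → lookup c v ≡ j))

SamePartition : {n k : ℕ} → Vec (Fin k) n → Vec (Fin k) n → Set
SamePartition c d = ∀ u v →
  (lookup c u ≡ lookup c v → lookup d u ≡ lookup d v) ×
  (lookup d u ≡ lookup d v → lookup c u ≡ lookup c v)

IsFixaticNumber : (n h : ℕ) → Set
IsFixaticNumber n h =
  (∃ λ (c : Vec (Fin h) n) → IsFixaticPartition n h c) ×
  (∀ (k : ℕ) (c : Vec (Fin k) n) → IsFixaticPartition n k c → k ≤ h)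

NumFixaticPartitions : (n h N : ℕ) → Set
NumFixaticPartitions n h N = Σ (List (Vec (Fin h) n)) λ L →
  (length L ≡ N) ×
  All (IsFixaticPartition n h) L ×
  AllPairs (λ c d → ¬ SamePartition c d) L ×
  (∀ (c : Vec (Fin h) n) → IsFixaticPartition n h c → Any (SamePartition c) L)

prodFact : List ℕ → ℕ
prodFact [] = 1
prodFact (k ∷ ks) = k ! * prodFact ks

prodFact≢0 : ∀ ks → NonZero (prodFact ks)
prodFact≢0 [] = _
prodFact≢0 (k ∷ ks) = m*n≢0 (k !) (prodFact ks) {{k !≢0}} {{prodFact≢0 ks}}

multinomial : ℕ → List ℕ → ℕ
multinomial m ks = _/_ (m !) (prodFact ks) {{prodFact≢0 ks}}

module Submission where

-- Graph theory (module `Cycle`): an automorphism of C_n that turns one edge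
-- forwards turns every edge forwards, so it is a rotation or a reflection;
-- as 2 is invertible modulo the odd n, a reflection fixes exactly one
-- vertex.  Hence a vertex set is fixing iff it has two distinct elements,
-- and a fixatic partition is exactly a partition whose classes all have at
-- least two vertices.  Such a partition has at most ⌊n/2⌋ = m + 1 classes.
--
-- Combinatorics: partitions are labellings `Fin n → Fin k` up to renaming
-- of labels (`_≈_`).  Deciding the class of the point 0 gives explicit lists
-- of representatives: `pairings` (2k points into k pairs) and
-- `pairingsWithTriple` (2k + 1 points into k classes of size at least two,
-- i.e. one triple and pairs).

open import Defs
open import Data.Nat using (ℕ; zero; suc; _+_; _*_; _∸_; _≤_; _<?_; _/_; _%_; _!; NonZero; z≤n; s≤s)
open import Data.Nat.Properties
  using ( _!≢0; 1+n≰n; n≮0; +-suc; +-comm; +-assoc; +-identityʳ; *-identityˡ; *-assoc; *-distribʳ-+; *-cancelʳ-≡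
        ; m+[n∸m]≡n; <⇒≤; ≤-antisym; ≤-pred; ≮⇒≥)
open import Data.Nat.DivMod
  using ( _mod_; m*n/n≡m; m/n≡1+[m∸n]/n; m%n<n; m%n%n≡m%n; [m+kn]%n≡m%n; n%n≡0
        ; %-distribˡ-+; %-distribˡ-*; m<n⇒m%n≡m)
open import Data.Nat.Divisibility using (_∣_; divides)
open import Data.Nat.Combinatorics using (_C_; nC1≡n; nCk+nC[k+1]≡[n+1]C[k+1])
open import Data.Nat.Tactic.RingSolver using (solve-∀)
open import Data.Fin using (Fin; zero; suc; toℕ; punchIn; punchOut; _≟_; splitAt; join)
open import Data.Fin.Properties
  using ( punchInᵢ≢i; punchIn-injective; punchOut-punchIn; punchOut-cong; punchIn-punchOut; suc-injective
        ; 0≢1+n; join-splitAt; injective⇒≤; any?; toℕ-fromℕ<; toℕ-injective; toℕ<n)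
open import Data.Fin.Permutation using (Permutation′; _⟨$⟩ʳ_; _⟨$⟩ˡ_; permutation; inverseˡ)
open import Data.Vec using (Vec; lookup; tabulate)
open import Data.Vec.Properties using (lookup∘tabulate)
open import Data.List using (List; []; _∷_; [_]; _++_; map; length; allFin; cartesianProductWith; replicate)
open import Data.List.Properties using (length-++; length-map; length-tabulate)
open import Data.List.Relation.Unary.All as All using (All; []; _∷_)
import Data.List.Relation.Unary.All.Properties as All
open import Data.List.Relation.Unary.Any as Any using (Any; here)
import Data.List.Relation.Unary.Any.Properties as Any
open import Data.List.Relation.Unary.AllPairs as AllPairs using (AllPairs; []; _∷_)
import Data.List.Relation.Unary.AllPairs.Properties as AllPairs
open import Data.List.Membership.Propositional using (find; lose)
open import Data.List.Membership.Propositional.Properties using (∈-allFin; ∈-cartesianProductWith⁺)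
open import Data.List.Relation.Unary.Unique.Propositional.Properties using (allFin⁺)
open import Data.Product using (Σ; ∃; _×_; _,_; proj₁; proj₂)
open import Data.Sum using (_⊎_; inj₁; inj₂)
open import Data.Empty using (⊥; ⊥-elim)
open import Function using (_∘_)
open import Function.Definitions using (Injective)
open import Level using (0ℓ)
open import Relation.Nullary using (¬_; Dec; yes; no)
open import Relation.Unary using (Decidable)
open import Relation.Binary.Bundles using (Setoid)
open import Relation.Binary.PropositionalEquality
  using (_≡_; _≢_; _≗_; refl; sym; trans; cong; cong₂; subst; subst₂; module ≡-Reasoning)

length-product : ∀ {A B C : Set} (f : A → B → C) (xs : List A) (ys : List B) →
  length (cartesianProductWith f xs ys) ≡ length xs * length ys
length-product f [] ys = refl
length-product f (x ∷ xs) ys = begin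
  length (map (f x) ys ++ cartesianProductWith f xs ys) ≡⟨ length-++ (map (f x) ys) ⟩
  length (map (f x) ys) + length (cartesianProductWith f xs ys)
    ≡⟨ cong₂ _+_ (length-map (f x) ys) (length-product f xs ys) ⟩
  length ys + length xs * length ys ∎
  where open ≡-Reasoning

All-product : ∀ {A B C : Set} {P : A → Set} {R : B → Set} {Q : C → Set} (f : A → B → C) →
  (∀ {x y} → P x → R y → Q (f x y)) →
  ∀ {xs ys} → All P xs → All R ys → All Q (cartesianProductWith f xs ys)
All-product f pres []         rys = []
All-product f pres (px ∷ pxs) rys = All.++⁺ (All.map⁺ (All.map (pres px) rys)) (All-product f pres pxs rys)

AllPairs-product : ∀ {A B C : Set} {P : A → Set}
  {_#₁_ : A → A → Set} {_#₂_ : B → B → Set} {_#_ : C → C → Set}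
  (f : A → B → C) {xs : List A} {ys : List B} →
  (∀ {x x' y y'} → x #₁ x' → f x y # f x' y') →
  (∀ {x y y'} → P x → y #₂ y' → f x y # f x y') →
  All P xs → AllPairs _#₁_ xs → AllPairs _#₂_ ys →
  AllPairs _#_ (cartesianProductWith f xs ys)
AllPairs-product f across within [] [] ys# = []
AllPairs-product f {ys = ys} across within (px ∷ pxs) (x#xs ∷ xs#) ys# =
  AllPairs.++⁺ (AllPairs.map⁺ (AllPairs.map (within px) ys#))
               (AllPairs-product f across within pxs xs# ys#)
               (All.map⁺ (All.universal (λ y →
                  All-product f (λ x#x' _ → across x#x') x#xs (All.universal-U ys)) ys))

-- A labelling `f : Fin m → Fin k` describes the partition of `Fin m` into
-- the classes `f⁻¹(j)`.
infix 4 _≈_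
_≈_ : ∀ {m k k'} → (Fin m → Fin k) → (Fin m → Fin k') → Set
f ≈ g = ∀ u v → (f u ≡ f v → g u ≡ g v) × (g u ≡ g v → f u ≡ f v)

≈-sym : ∀ {m k k'} {f : Fin m → Fin k} {g : Fin m → Fin k'} → f ≈ g → g ≈ f
≈-sym f≈g u v = proj₂ (f≈g u v) , proj₁ (f≈g u v)

≈-trans : ∀ {m k k' k''} {f : Fin m → Fin k} {g : Fin m → Fin k'} {h : Fin m → Fin k''} →
  f ≈ g → g ≈ h → f ≈ h
≈-trans f≈g g≈h u v = (λ e → proj₁ (g≈h u v) (proj₁ (f≈g u v) e))
                    , (λ e → proj₂ (f≈g u v) (proj₂ (g≈h u v) e))

record TwoIn {m k} (f : Fin m → Fin k) (j : Fin k) : Set where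
  constructor two
  field
    fst snd  : Fin m
    distinct : fst ≢ snd
    fst∈     : f fst ≡ j
    snd∈     : f snd ≡ j

open TwoIn

AtLeastTwo : ∀ {m k} → (Fin m → Fin k) → Set
AtLeastTwo f = ∀ j → TwoIn f j

module _ {m k k'} {f : Fin m → Fin k'} {g : Fin m → Fin k} {σ : Fin k → Fin k'}
         (σ-injective : Injective _≡_ _≡_ σ) (f≡σ∘g : ∀ u → f u ≡ σ (g u)) where

  ≈-relabel : f ≈ g
  ≈-relabel u v = (λ e → σ-injective (trans (sym (f≡σ∘g u)) (trans e (f≡σ∘g v))))
                , (λ e → trans (f≡σ∘g u) (trans (cong σ e) (sym (f≡σ∘g v))))

  AtLeastTwo-relabel : AtLeastTwo f → AtLeastTwo g
  AtLeastTwo-relabel f-two j with f-two (σ j)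
  ... | two a b a≢b fa fb = two a b a≢b (inGClass fa) (inGClass fb)
    where
    inGClass : ∀ {u} → f u ≡ σ j → g u ≡ j
    inGClass {u} fu = σ-injective (trans (sym (f≡σ∘g u)) fu)

≈-resp-≗ : ∀ {m k k'} {f f' : Fin m → Fin k} {g g' : Fin m → Fin k'} →
  f ≗ f' → g ≗ g' → f ≈ g → f' ≈ g'
≈-resp-≗ {m} f≗f' g≗g' f≈g u v =
  (λ e → transport g≗g' (proj₁ (f≈g u v) (transport (sym ∘ f≗f') e)))
  , (λ e → transport f≗f' (proj₂ (f≈g u v) (transport (sym ∘ g≗g') e)))
  where
  transport : ∀ {k} {h h' : Fin m → Fin k} → h ≗ h' → h u ≡ h v → h' u ≡ h' v
  transport h≗h' e = trans (sym (h≗h' u)) (trans e (h≗h' v))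

AtLeastTwo-resp-≗ : ∀ {m k} {f g : Fin m → Fin k} → f ≗ g → AtLeastTwo f → AtLeastTwo g
AtLeastTwo-resp-≗ f≗g f-two j with f-two j
... | two a b a≢b fa fb = two a b a≢b (trans (sym (f≗g a)) fa) (trans (sym (f≗g b)) fb)

-- If every one of `k` classes has two points then there are at least
-- `k + k` points: choosing two points per class is injective.
class-bound : ∀ {m k} (f : Fin m → Fin k) → AtLeastTwo f → k + k ≤ m
class-bound {m} {k} f f-two = injective⇒≤ {f = pick ∘ splitAt k} λ {u} {v} e →
    trans (sym (join-splitAt k k u))
          (trans (cong (join k k) (pick-injective {splitAt k u} {splitAt k v} e)) (join-splitAt k k v))
  where
  pick : Fin k ⊎ Fin k → Fin m
  pick (inj₁ j) = fst (f-two j)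
  pick (inj₂ j) = snd (f-two j)

  label : Fin k ⊎ Fin k → Fin k
  label (inj₁ j) = j
  label (inj₂ j) = j

  pick-label : ∀ s → f (pick s) ≡ label s
  pick-label (inj₁ j) = fst∈ (f-two j)
  pick-label (inj₂ j) = snd∈ (f-two j)

  pick-injective : ∀ {s s'} → pick s ≡ pick s' → s ≡ s'
  pick-injective {s} {s'} e with trans (sym (pick-label s)) (trans (cong f e) (pick-label s'))
  pick-injective {inj₁ j} {inj₁ .j} e | refl = refl
  pick-injective {inj₂ j} {inj₂ .j} e | refl = refl
  pick-injective {inj₁ j} {inj₂ .j} e | refl = ⊥-elim (distinct (f-two j) e)
  pick-injective {inj₂ j} {inj₁ .j} e | refl = ⊥-elim (distinct (f-two j) (sym e))

-- Adding a two-point class: on `Fin (2 + m)` the points `0` and `1 + i`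
-- form the new class `0`, and the other points, numbered by `punchIn i`,
-- keep their class under `f` (shifted up by one).
pairWith : ∀ {m k} → Fin (suc m) → (Fin m → Fin k) → Fin (suc (suc m)) → Fin (suc k)
pairWith i f zero = zero
pairWith i f (suc p) with i ≟ p
... | yes _ = zero
... | no i≢p = suc (f (punchOut i≢p))

data Position {m} (i : Fin (suc m)) : Fin (suc (suc m)) → Set where
  first   : Position i zero
  partner : Position i (suc i)
  other   : ∀ y → Position i (suc (punchIn i y))

position : ∀ {m} (i : Fin (suc m)) u → Position i u
position i zero = first
position i (suc p) with i ≟ p
... | yes refl = partner
... | no i≢p = subst (λ q → Position i (suc q)) (punchIn-punchOut i≢p) (other (punchOut i≢p))

classAt : ∀ {m k} {i : Fin (suc m)} {u} → Position i u → (Fin m → Fin k) → Fin (suc k)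
classAt first     f = zero
classAt partner   f = zero
classAt (other y) f = suc (f y)

pairWith-position : ∀ {m k} {i : Fin (suc m)} {u} (p : Position i u) (f : Fin m → Fin k) →
  pairWith i f u ≡ classAt p f
pairWith-position first f = refl
pairWith-position {i = i} partner f with i ≟ i
... | yes _ = refl
... | no i≢i = ⊥-elim (i≢i refl)
pairWith-position {i = i} (other y) f with i ≟ punchIn i y
... | yes i≡y↑ = ⊥-elim (punchInᵢ≢i i y (sym i≡y↑))
... | no i≢y↑ = cong (λ z → suc (f z)) (trans (punchOut-cong i refl) (punchOut-punchIn i))

pairWith-other : ∀ {m k} (i : Fin (suc m)) (f : Fin m → Fin k) y →
  pairWith i f (suc (punchIn i y)) ≡ suc (f y)
pairWith-other i f y = pairWith-position (other y) f

classAt-cong : ∀ {m k k'} {i : Fin (suc m)} {f : Fin m → Fin k} {g : Fin m → Fin k'} → f ≈ g →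
  ∀ {u v} (p : Position i u) (q : Position i v) → classAt p f ≡ classAt q f → classAt p g ≡ classAt q g
classAt-cong f≈g first     first     e = refl
classAt-cong f≈g first     partner   e = refl
classAt-cong f≈g partner   first     e = refl
classAt-cong f≈g partner   partner   e = refl
classAt-cong f≈g first     (other z) e = ⊥-elim (0≢1+n e)
classAt-cong f≈g partner   (other z) e = ⊥-elim (0≢1+n e)
classAt-cong f≈g (other y) first     e = ⊥-elim (0≢1+n (sym e))
classAt-cong f≈g (other y) partner   e = ⊥-elim (0≢1+n (sym e))
classAt-cong f≈g (other y) (other z) e = cong suc (proj₁ (f≈g y z) (suc-injective e))

pairWith-cong : ∀ {m k k'} (i : Fin (suc m)) {f : Fin m → Fin k} {g : Fin m → Fin k'} →
  f ≈ g → pairWith i f ≈ pairWith i g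
pairWith-cong i f≈g u v = transport f≈g , transport (≈-sym f≈g)
  where
  transport : ∀ {k k'} {f : Fin _ → Fin k} {g : Fin _ → Fin k'} → f ≈ g →
    pairWith i f u ≡ pairWith i f v → pairWith i g u ≡ pairWith i g v
  transport {f = f} {g} f≈g e =
    let p = position i u ; q = position i v in
    trans (pairWith-position p g)
      (trans (classAt-cong f≈g p q (trans (sym (pairWith-position p f)) (trans e (pairWith-position q f))))
             (sym (pairWith-position q g)))

pairWith-partner-unique : ∀ {m k k'} {i i' : Fin (suc m)} {f : Fin m → Fin k} {f' : Fin m → Fin k'} →
  pairWith i f ≈ pairWith i' f' → i ≡ i'
pairWith-partner-unique {i = i} {i'} {f} {f'} s = unique (position i' (suc i)) refl
  where
  unique : ∀ {u} → Position i' u → u ≡ suc i → i ≡ i'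
  unique partner   refl = refl
  unique (other y) refl = ⊥-elim (0≢1+n (trans
    (proj₁ (s zero (suc i)) (sym (pairWith-position partner f))) (pairWith-other i' f' y)))

pairWith-restrict : ∀ {m k k'} {i : Fin (suc m)} {f : Fin m → Fin k} {g : Fin m → Fin k'} →
  pairWith i f ≈ pairWith i g → f ≈ g
pairWith-restrict {i = i} {f} {g} s y z = through f g (proj₁ (s y↑ z↑)) , through g f (proj₂ (s y↑ z↑))
  where
  y↑ = suc (punchIn i y)
  z↑ = suc (punchIn i z)
  through : ∀ {k k'} (f : Fin _ → Fin k) (g : Fin _ → Fin k') →
    (pairWith i f y↑ ≡ pairWith i f z↑ → pairWith i g y↑ ≡ pairWith i g z↑) → f y ≡ f z → g y ≡ g z
  through f g h e = suc-injective (trans (sym (pairWith-other i g y))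
    (trans (h (trans (pairWith-other i f y) (trans (cong suc e) (sym (pairWith-other i f z)))))
           (pairWith-other i g z)))

pairWith-AtLeastTwo : ∀ {m k} (i : Fin (suc m)) {f : Fin m → Fin k} →
  AtLeastTwo f → AtLeastTwo (pairWith i f)
pairWith-AtLeastTwo i {f} f-two zero = two zero (suc i) 0≢1+n refl (pairWith-position partner f)
pairWith-AtLeastTwo i {f} f-two (suc j) with f-two j
... | two a b a≢b fa fb = two (suc (punchIn i a)) (suc (punchIn i b))
        (λ e → a≢b (punchIn-injective i a b (suc-injective e)))
        (trans (pairWith-other i f a) (cong suc fa)) (trans (pairWith-other i f b) (cong suc fb))

pairWith-suc⁻ : ∀ {m k} {i : Fin (suc m)} {f : Fin m → Fin k} {j u} → Position i u →
  pairWith i f u ≡ suc j → Σ (Fin m) λ y → u ≡ suc (punchIn i y) × f y ≡ j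
pairWith-suc⁻         first     e = ⊥-elim (0≢1+n e)
pairWith-suc⁻ {f = f} partner   e = ⊥-elim (0≢1+n (trans (sym (pairWith-position partner f)) e))
pairWith-suc⁻ {i = i} {f} (other y) e = y , refl , suc-injective (trans (sym (pairWith-other i f y)) e)

pairWith-AtLeastTwo⁻ : ∀ {m k} (i : Fin (suc m)) {f : Fin m → Fin k} →
  AtLeastTwo (pairWith i f) → AtLeastTwo f
pairWith-AtLeastTwo⁻ i pf-two j with pf-two (suc j)
... | two a b a≢b fa fb with pairWith-suc⁻ (position i a) fa | pairWith-suc⁻ (position i b) fb
...   | y , refl , fy | z , refl , fz = two y z (λ { refl → a≢b refl }) fy fz

extend : ∀ {m k} → (Fin m → Fin k) → Fin k → Fin (suc m) → Fin k
extend p b zero    = b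
extend p b (suc x) = p x

extend-AtLeastTwo : ∀ {m k} {p : Fin m → Fin k} (b : Fin k) → AtLeastTwo p → AtLeastTwo (extend p b)
extend-AtLeastTwo b p-two j with p-two j
... | two x y x≢y px py = two (suc x) (suc y) (λ e → x≢y (suc-injective e)) px py

extend-restrict : ∀ {m k} {p p' : Fin m → Fin k} {b b'} → extend p b ≈ extend p' b' → p ≈ p'
extend-restrict s u v = s (suc u) (suc v)

extend-label : ∀ {m k} {p : Fin m → Fin k} {b b'} → AtLeastTwo p → extend p b ≈ extend p b' → b ≡ b'
extend-label {b = b} p-two s with p-two b
... | two x _ _ px _ = trans (sym px) (sym (proj₁ (s zero (suc x)) (sym px)))

-- In `pairWith i d` the class of `0` has two points, in `extend p b` at
-- least three.
pairWith≉extend : ∀ {m k} (i : Fin (suc m)) (d : Fin m → Fin k) {p : Fin (suc m) → Fin (suc k)} (b : Fin (suc k)) →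
  AtLeastTwo p → ¬ pairWith i d ≈ extend p b
pairWith≉extend i d {p} b p-two s with p-two b
... | two x y x≢y px py = x≢y (trans (is-partner x px) (sym (is-partner y py)))
  where
  is-partner : ∀ x → p x ≡ b → x ≡ i
  is-partner x px with position i (suc x) | proj₂ (s zero (suc x)) (sym px)
  ... | partner   | _ = refl
  ... | other y   | e = ⊥-elim (0≢1+n (trans e (pairWith-other i d y)))

partner-of-zero : ∀ {m k} (c : Fin (suc (suc m)) → Fin k) → AtLeastTwo c →
  Σ (Fin (suc m)) λ i → c (suc i) ≡ c zero
partner-of-zero c c-two with c-two (c zero)
... | two zero    zero    0≢0 _  _  = ⊥-elim (0≢0 refl)
... | two zero    (suc b) _   _  cb = b , cb
... | two (suc a) _       _   ca _  = a , ca

tail-AtLeastTwo : ∀ {m k} (c : Fin (suc m) → Fin k) {a b : Fin m} → a ≢ b →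
  c (suc a) ≡ c zero → c (suc b) ≡ c zero → AtLeastTwo c → AtLeastTwo (c ∘ suc)
tail-AtLeastTwo c {a} {b} a≢b ca cb c-two j with j ≟ c zero | c-two j
... | yes refl | _                           = two a b a≢b ca cb
... | no j≢c0  | two zero    _       _  e  _  = ⊥-elim (j≢c0 (sym e))
... | no j≢c0  | two (suc _) zero    _  _  e  = ⊥-elim (j≢c0 (sym e))
... | no j≢c0  | two (suc x) (suc y) ne ex ey = two x y (λ e → ne (cong suc e)) ex ey

≈-extend : ∀ {m k k'} (c : Fin (suc m) → Fin k) (p : Fin m → Fin k') (i : Fin m) →
  c (suc i) ≡ c zero → c ∘ suc ≈ p → c ≈ extend p (p i)
≈-extend c p i ci s zero    zero    = (λ _ → refl) , (λ _ → refl)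
≈-extend c p i ci s zero    (suc v) = (λ e → proj₁ (s i v) (trans ci e))
                                    , (λ e → trans (sym ci) (proj₂ (s i v) e))
≈-extend c p i ci s (suc u) zero    = (λ e → proj₁ (s u i) (trans e (sym ci)))
                                    , (λ e → trans (proj₂ (s u i) e) ci)
≈-extend c p i ci s (suc u) (suc v) = s u v

remove-pair : ∀ {m k} (c : Fin (suc (suc m)) → Fin (suc k)) (i : Fin (suc m)) →
  c (suc i) ≡ c zero → (∀ y → c (suc (punchIn i y)) ≢ c zero) → AtLeastTwo c →
  Σ (Fin m → Fin k) λ d → c ≈ pairWith i d × AtLeastTwo d
remove-pair c i ci alone c-two =
  d , ≈-relabel toFront-injective c≡toFront
    , pairWith-AtLeastTwo⁻ i (AtLeastTwo-relabel toFront-injective c≡toFront c-two)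
  where
  d : Fin _ → Fin _
  d y = punchOut (λ e → alone y (sym e))

  toFront : Fin (suc _) → Fin (suc _)
  toFront zero    = c zero
  toFront (suc j) = punchIn (c zero) j

  toFront-injective : Injective _≡_ _≡_ toFront
  toFront-injective {zero}  {zero}  e = refl
  toFront-injective {zero}  {suc b} e = ⊥-elim (punchInᵢ≢i (c zero) b (sym e))
  toFront-injective {suc a} {zero}  e = ⊥-elim (punchInᵢ≢i (c zero) a e)
  toFront-injective {suc a} {suc b} e = cong suc (punchIn-injective (c zero) a b e)

  at-position : ∀ {u} → Position i u → c u ≡ toFront (pairWith i d u)
  at-position first     = refl
  at-position partner   = trans ci (cong toFront (sym (pairWith-position {i = i} partner d)))
  at-position (other y) = trans (sym (punchIn-punchOut (λ e → alone y (sym e))))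
                                (cong toFront (sym (pairWith-other i d y)))

  c≡toFront : ∀ u → c u ≡ toFront (pairWith i d u)
  c≡toFront u = at-position (position i u)

-- `double k = 2k`, by a recursion making `double (1 + k)` definitionally
-- `2 + double k`, which is how the lists below grow.
double : ℕ → ℕ
double zero    = zero
double (suc k) = suc (suc (double k))

double≡+ : ∀ k → double k ≡ k + k
double≡+ zero    = refl
double≡+ (suc k) = cong suc (trans (cong suc (double≡+ k)) (sym (+-suc k k)))

-- Representatives of the partitions of `Fin (2k)` into `k` pairs: the
-- partner `1 + i` of `0` is chosen, then the rest is paired recursively.
pairings : (k : ℕ) → List (Fin (double k) → Fin k)
pairings zero    = [ (λ ()) ]
pairings (suc k) = cartesianProductWith pairWith (allFin (suc (double k))) (pairings k)

-- Representatives of the partitions of `Fin (2k+1)` into `k` classes of size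
-- at least two, i.e. one triple and `k - 1` pairs: either `0` lies in a pair
-- `{0, 1 + i}`, or `0` is added to one of the `k` pairs of a pairing of the
-- other `2k` points.
pairingsWithTriple : (k : ℕ) → List (Fin (suc (double k)) → Fin k)
pairingsWithTriple zero    = []
pairingsWithTriple (suc k) =
  cartesianProductWith pairWith (allFin (suc (suc (double k)))) (pairingsWithTriple k)
  ++ cartesianProductWith extend (pairings (suc k)) (allFin (suc k))

pairingsCount : ℕ → ℕ
pairingsCount zero    = 1
pairingsCount (suc k) = suc (double k) * pairingsCount k

tripleCount : ℕ → ℕ
tripleCount zero    = 0
tripleCount (suc k) = suc (suc (double k)) * tripleCount k + pairingsCount (suc k) * suc k

length-allFin : ∀ n → length (allFin n) ≡ n
length-allFin n = length-tabulate (λ i → i)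

length-pairings : ∀ k → length (pairings k) ≡ pairingsCount k
length-pairings zero    = refl
length-pairings (suc k) = trans (length-product pairWith (allFin (suc (double k))) (pairings k))
  (cong₂ _*_ (length-allFin (suc (double k))) (length-pairings k))

length-pairingsWithTriple : ∀ k → length (pairingsWithTriple k) ≡ tripleCount k
length-pairingsWithTriple zero    = refl
length-pairingsWithTriple (suc k) = trans (length-++ (cartesianProductWith pairWith points (pairingsWithTriple k)))
  (cong₂ _+_ (trans (length-product pairWith points (pairingsWithTriple k))
                    (cong₂ _*_ (length-allFin (suc (suc (double k)))) (length-pairingsWithTriple k)))
             (trans (length-product extend (pairings (suc k)) (allFin (suc k)))
                    (cong₂ _*_ (length-pairings (suc k)) (length-allFin (suc k)))))
  where points = allFin (suc (suc (double k)))

pairings-AtLeastTwo : ∀ k → All AtLeastTwo (pairings k)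
pairings-AtLeastTwo zero    = (λ ()) ∷ []
pairings-AtLeastTwo (suc k) = All-product pairWith (λ {i} _ → pairWith-AtLeastTwo i)
  (All.universal-U (allFin (suc (double k)))) (pairings-AtLeastTwo k)

pairingsWithTriple-AtLeastTwo : ∀ k → All AtLeastTwo (pairingsWithTriple k)
pairingsWithTriple-AtLeastTwo zero    = []
pairingsWithTriple-AtLeastTwo (suc k) = All.++⁺
  (All-product pairWith (λ {i} _ → pairWith-AtLeastTwo i)
     (All.universal-U (allFin (suc (suc (double k))))) (pairingsWithTriple-AtLeastTwo k))
  (All-product extend (λ {_} {b} p-two _ → extend-AtLeastTwo b p-two)
     (pairings-AtLeastTwo (suc k)) (All.universal-U (allFin (suc k))))

_≉_ : ∀ {m k} → (Fin m → Fin k) → (Fin m → Fin k) → Set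
f ≉ g = ¬ f ≈ g

-- A product list built by `pairWith` from a repetition-free list is
-- repetition-free, because `pairWith` is injective up to `≈`.
pairWith-product-distinct : ∀ {m k} (L : List (Fin m → Fin k)) → AllPairs _≉_ L →
  AllPairs _≉_ (cartesianProductWith pairWith (allFin (suc m)) L)
pairWith-product-distinct {m} L L-distinct = AllPairs-product pairWith
  (λ i≢i' s → i≢i' (pairWith-partner-unique s)) (λ _ d≉d' s → d≉d' (pairWith-restrict s))
  (All.universal-U (allFin (suc m))) (allFin⁺ (suc m)) L-distinct

pairings-distinct : ∀ k → AllPairs _≉_ (pairings k)
pairings-distinct zero    = [] ∷ []
pairings-distinct (suc k) = pairWith-product-distinct (pairings k) (pairings-distinct k)

pairingsWithTriple-distinct : ∀ k → AllPairs _≉_ (pairingsWithTriple k)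
pairingsWithTriple-distinct zero    = []
-- The two halves are repetition-free (`extend` is injective up to `≈`) and
-- disjoint: the class of `0` is a pair in the first half, a triple in the second.
pairingsWithTriple-distinct (suc k) = AllPairs.++⁺
  (pairWith-product-distinct (pairingsWithTriple k) (pairingsWithTriple-distinct k))
  (AllPairs-product extend (λ p≉p' s → p≉p' (extend-restrict s)) (λ p-two b≢b' s → b≢b' (extend-label p-two s))
     (pairings-AtLeastTwo (suc k)) (pairings-distinct (suc k)) (allFin⁺ (suc k)))
  (All-product pairWith
     (λ {i} {d} _ _ → All-product extend (λ {_} {b} p-two _ → pairWith≉extend i d b p-two)
                        (pairings-AtLeastTwo (suc k)) (All.universal-U (allFin (suc k))))
     (All.universal-U (allFin (suc (suc (double k))))) (All.universal-U (pairingsWithTriple k)))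

complete-pairWith : ∀ {m k} (L : List (Fin m → Fin k)) → (∀ d → AtLeastTwo d → Any (d ≈_) L) →
  (c : Fin (suc (suc m)) → Fin (suc k)) (i : Fin (suc m)) →
  c (suc i) ≡ c zero → (∀ y → c (suc (punchIn i y)) ≢ c zero) → AtLeastTwo c →
  Any (c ≈_) (cartesianProductWith pairWith (allFin (suc m)) L)
complete-pairWith L L-complete c i ci alone c-two with remove-pair c i ci alone c-two
... | d , c≈ , d-two = Any.cartesianProductWith⁺ pairWith
        (λ { refl d≈d' → ≈-trans c≈ (pairWith-cong i d≈d') }) (∈-allFin i) (L-complete d d-two)

pairings-complete : ∀ k (c : Fin (double k) → Fin k) → AtLeastTwo c → Any (c ≈_) (pairings k)
pairings-complete zero    c c-two = here (λ ())
pairings-complete (suc k) c c-two with partner-of-zero c c-two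
... | i , ci = complete-pairWith (pairings k) (pairings-complete k) c i ci alone c-two
  where
  -- A third point in the class of `0` would leave `2k + 1` points with `k + 1` classes of size ≥ 2.
  alone : ∀ y → c (suc (punchIn i y)) ≢ c zero
  alone y cy = 1+n≰n (subst (_≤ suc (double k)) (sym (double≡+ (suc k)))
    (class-bound (c ∘ suc) (tail-AtLeastTwo c (λ e → punchInᵢ≢i i y (sym e)) ci cy c-two)))

pairingsWithTriple-complete : ∀ k (c : Fin (suc (double k)) → Fin k) → AtLeastTwo c →
  Any (c ≈_) (pairingsWithTriple k)
pairingsWithTriple-complete zero    c c-two = ⊥-elim (no-label (c zero))
  where
  no-label : Fin 0 → ⊥
  no-label ()
pairingsWithTriple-complete (suc k) c c-two =
  let (i , ci) = partner-of-zero c c-two in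
  by-class-of-zero i ci (any? (λ y → c (suc (punchIn i y)) ≟ c zero))
  where
  by-class-of-zero : ∀ i → c (suc i) ≡ c zero → Dec (∃ λ y → c (suc (punchIn i y)) ≡ c zero) →
    Any (c ≈_) (pairingsWithTriple (suc k))
  by-class-of-zero i ci (no third) = Any.++⁺ˡ (complete-pairWith (pairingsWithTriple k) (pairingsWithTriple-complete k)
                                c i ci (λ y cy → third (y , cy)) c-two)
  by-class-of-zero i ci (yes (y , cy)) =
    let (p , p∈ , tail≈p) = find (pairings-complete (suc k) (c ∘ suc)
                                    (tail-AtLeastTwo c (λ e → punchInᵢ≢i i y (sym e)) ci cy c-two))
    in Any.++⁺ʳ (cartesianProductWith pairWith (allFin (suc (suc (double k)))) (pairingsWithTriple k))
                (lose (∈-cartesianProductWith⁺ extend p∈ (∈-allFin (p i))) (≈-extend c p i ci tail≈p))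

choose2 : ∀ n → (suc (suc n) C 2) * 2 ≡ suc (suc n) * suc n
choose2 zero    = refl
choose2 (suc n) = begin
  (suc (suc (suc n)) C 2) * 2              ≡⟨ cong (_* 2) (sym (nCk+nC[k+1]≡[n+1]C[k+1] (suc (suc n)) 1)) ⟩
  (suc (suc n) C 1 + suc (suc n) C 2) * 2  ≡⟨ cong (λ x → (x + suc (suc n) C 2) * 2) (nC1≡n (suc (suc n))) ⟩
  (suc (suc n) + suc (suc n) C 2) * 2      ≡⟨ *-distribʳ-+ 2 (suc (suc n)) (suc (suc n) C 2) ⟩
  suc (suc n) * 2 + (suc (suc n) C 2) * 2  ≡⟨ cong (suc (suc n) * 2 +_) (choose2 n) ⟩
  suc (suc n) * 2 + suc (suc n) * suc n    ≡⟨ regroup n ⟩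
  suc (suc (suc n)) * suc (suc n)          ∎
  where
  open ≡-Reasoning
  regroup : ∀ n → suc (suc n) * 2 + suc (suc n) * suc n ≡ suc (suc (suc n)) * suc (suc n)
  regroup = solve-∀

choose3 : ∀ n → (suc (suc (suc n)) C 3) * 6 ≡ suc (suc (suc n)) * suc (suc n) * suc n
choose3 zero    = refl
choose3 (suc n) = begin
  (suc (suc (suc (suc n))) C 3) * 6
    ≡⟨ cong (_* 6) (sym (nCk+nC[k+1]≡[n+1]C[k+1] (suc (suc (suc n))) 2)) ⟩
  (suc (suc (suc n)) C 2 + suc (suc (suc n)) C 3) * 6
    ≡⟨ split (suc (suc (suc n)) C 2) (suc (suc (suc n)) C 3) ⟩
  (suc (suc (suc n)) C 2) * 2 * 3 + (suc (suc (suc n)) C 3) * 6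
    ≡⟨ cong₂ (λ x y → x * 3 + y) (choose2 (suc n)) (choose3 n) ⟩
  suc (suc (suc n)) * suc (suc n) * 3 + suc (suc (suc n)) * suc (suc n) * suc n
    ≡⟨ regroup n ⟩
  suc (suc (suc (suc n))) * suc (suc (suc n)) * suc (suc n) ∎
  where
  open ≡-Reasoning
  split : ∀ a b → (a + b) * 6 ≡ a * 2 * 3 + b * 6
  split = solve-∀
  regroup : ∀ n → suc (suc (suc n)) * suc (suc n) * 3 + suc (suc (suc n)) * suc (suc n) * suc n
                ≡ suc (suc (suc (suc n))) * suc (suc (suc n)) * suc (suc n)
  regroup = solve-∀

tripleCount-closed : ∀ m → tripleCount (suc m) * 6 ≡
  suc (suc (suc (double m))) * suc (suc (double m)) * suc (double m) * pairingsCount m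
tripleCount-closed zero    = refl
tripleCount-closed (suc m) = begin
  tripleCount (suc (suc m)) * 6
    ≡⟨ expand D T A m ⟩
  (4 + D) * (T * 6) + (3 + D) * (1 + D) * A * (suc (suc m) * 6)
    ≡⟨ cong₂ (λ x y → (4 + D) * x + (3 + D) * (1 + D) * A * y) (tripleCount-closed m) halves ⟩
  (4 + D) * ((3 + D) * (2 + D) * (1 + D) * A) + (3 + D) * (1 + D) * A * ((4 + D) * 3)
    ≡⟨ collect D A ⟩
  (5 + D) * (4 + D) * (3 + D) * ((1 + D) * A) ∎
  where
  open ≡-Reasoning
  D = double m
  T = tripleCount (suc m)
  A = pairingsCount m
  halves : suc (suc m) * 6 ≡ (4 + D) * 3
  halves = trans (six m) (cong (λ x → (4 + x) * 3) (sym (double≡+ m)))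
    where
    six : ∀ m → suc (suc m) * 6 ≡ (4 + (m + m)) * 3
    six = solve-∀
  expand : ∀ D T A m → ((4 + D) * T + (3 + D) * ((1 + D) * A) * suc (suc m)) * 6
                     ≡ (4 + D) * (T * 6) + (3 + D) * (1 + D) * A * (suc (suc m) * 6)
  expand = solve-∀
  collect : ∀ D A → (4 + D) * ((3 + D) * (2 + D) * (1 + D) * A) + (3 + D) * (1 + D) * A * ((4 + D) * 3)
                  ≡ (5 + D) * (4 + D) * (3 + D) * ((1 + D) * A)
  collect = solve-∀

tripleCount≡ : ∀ m → tripleCount (suc m) ≡ (suc (suc (suc (double m))) C 3) * pairingsCount m
tripleCount≡ m = *-cancelʳ-≡ _ _ 6 (begin
  tripleCount (suc m) * 6                      ≡⟨ tripleCount-closed m ⟩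
  suc (suc (suc D)) * suc (suc D) * suc D * A  ≡⟨ cong (_* A) (sym (choose3 D)) ⟩
  (suc (suc (suc D)) C 3) * 6 * A              ≡⟨ swap (suc (suc (suc D)) C 3) A ⟩
  (suc (suc (suc D)) C 3) * A * 6              ∎)
  where
  open ≡-Reasoning
  D = double m
  A = pairingsCount m
  swap : ∀ c a → c * 6 * a ≡ c * a * 6
  swap = solve-∀

-- `(2m)! = m! · (2m − 1)!! · 2!^m`, by induction from
-- `(2m + 2)! = (2m + 2)(2m + 1) · (2m)!` and `2m + 2 = 2 (m + 1)`.
double-factorial : ∀ m → double m ! ≡ (m ! * pairingsCount m) * prodFact (replicate m 2)
double-factorial zero    = refl
double-factorial (suc m) = begin
  (2 + D) * ((1 + D) * D !)                   ≡⟨ cong (λ x → (2 + D) * ((1 + D) * x)) (double-factorial m) ⟩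
  (2 + D) * ((1 + D) * (F * A * P))           ≡⟨ cong (λ x → (2 + x) * ((1 + D) * (F * A * P))) (double≡+ m) ⟩
  (2 + (m + m)) * ((1 + D) * (F * A * P))     ≡⟨ regroup m D F A P ⟩
  (suc m * F * ((1 + D) * A)) * (2 * P)       ∎
  where
  open ≡-Reasoning
  D = double m
  F = m !
  A = pairingsCount m
  P = prodFact (replicate m 2)
  regroup : ∀ m D F A P → (2 + (m + m)) * ((1 + D) * (F * A * P)) ≡ (suc m * F * ((1 + D) * A)) * (2 * P)
  regroup = solve-∀

/-exact : ∀ a b .{{_ : NonZero b}} c → a ≡ c * b → a / b ≡ c
/-exact _ b c refl = m*n/n≡m c b

multinomial-pairs : ∀ m → multinomial (double m) (replicate m 2) ≡ m ! * pairingsCount m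
multinomial-pairs m = /-exact (double m !) (prodFact (replicate m 2)) {{prodFact≢0 (replicate m 2)}}
  (m ! * pairingsCount m) (double-factorial m)

count-formula : ∀ m →
  _/_ ((suc (double (suc m)) C 3) * multinomial (double m) (replicate m 2)) (m !) {{m !≢0}}
    ≡ tripleCount (suc m)
count-formula m = trans (/-exact _ (m !) {{m !≢0}} (C3 * pairingsCount m) numerator≡) (sym (tripleCount≡ m))
  where
  C3 = suc (double (suc m)) C 3
  rotate : ∀ c f a → c * (f * a) ≡ c * a * f
  rotate = solve-∀
  numerator≡ : C3 * multinomial (double m) (replicate m 2) ≡ C3 * pairingsCount m * m !
  numerator≡ = trans (cong (C3 *_) (multinomial-pairs m)) (rotate C3 (m !) (pairingsCount m))

module Cycle (q : ℕ) where

  N : ℕ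
  N = suc (suc (suc q))

  -- Congruence modulo `N` (a record, so that both sides stay visible to
  -- type inference), and its compatibility with `+` and `*`.
  infix 4 _≋_
  record _≋_ (x y : ℕ) : Set where
    constructor mod≡
    field mod-eq : x % N ≡ y % N
  open _≋_

  ≋-setoid : Setoid 0ℓ 0ℓ
  ≋-setoid = record
    { Carrier = ℕ ; _≈_ = _≋_
    ; isEquivalence = record
      { refl  = mod≡ refl
      ; sym   = λ e → mod≡ (sym (mod-eq e))
      ; trans = λ e e' → mod≡ (trans (mod-eq e) (mod-eq e'))
      }
    }

  open Setoid ≋-setoid using () renaming (refl to ≋-refl; sym to ≋-sym; trans to ≋-trans)
  open import Relation.Binary.Reasoning.Setoid ≋-setoid

  ≋-+ : ∀ {x y z w} → x ≋ y → z ≋ w → x + z ≋ y + w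
  ≋-+ {x} {y} {z} {w} (mod≡ e) (mod≡ e') =
    mod≡ (trans (%-distribˡ-+ x z N) (trans (cong₂ (λ r s → (r + s) % N) e e') (sym (%-distribˡ-+ y w N))))

  ≋-* : ∀ {x y z w} → x ≋ y → z ≋ w → x * z ≋ y * w
  ≋-* {x} {y} {z} {w} (mod≡ e) (mod≡ e') =
    mod≡ (trans (%-distribˡ-* x z N) (trans (cong₂ (λ r s → (r * s) % N) e e') (sym (%-distribˡ-* y w N))))

  ≋-multiple : ∀ x k → x + k * N ≋ x
  ≋-multiple x k = mod≡ ([m+kn]%n≡m%n x k N)

  ≋-% : ∀ x → x % N ≋ x
  ≋-% x = mod≡ (m%n%n≡m%n x N)

  -- Adding `N ∸ (z % N)` undoes adding `z`, so addition can be cancelled.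
  ≋-cancelʳ : ∀ {x y} z → x + z ≋ y + z → x ≋ y
  ≋-cancelʳ {x} {y} z e = ≋-trans (≋-sym (undo x)) (≋-trans (≋-+ e ≋-refl) (undo y))
    where
    undo : ∀ x → x + z + (N ∸ z % N) ≋ x
    undo x = begin
      x + z + (N ∸ z % N)       ≈⟨ ≋-+ (≋-+ (≋-refl {x}) (≋-% z)) ≋-refl ⟨
      x + z % N + (N ∸ z % N)   ≡⟨ +-assoc x (z % N) (N ∸ z % N) ⟩
      x + (z % N + (N ∸ z % N)) ≡⟨ cong (x +_) (m+[n∸m]≡n (<⇒≤ (m%n<n z N))) ⟩
      x + N                     ≡⟨ cong (x +_) (sym (+-identityʳ N)) ⟩
      x + 1 * N                 ≈⟨ ≋-multiple x 1 ⟩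
      x                         ∎

  ⟦_⟧ : ℕ → Fin N
  ⟦ x ⟧ = x mod N

  toℕ-⟦⟧ : ∀ x → toℕ ⟦ x ⟧ ≡ x % N
  toℕ-⟦⟧ x = toℕ-fromℕ< (m%n<n x N)

  ⟦⟧≋ : ∀ x → toℕ ⟦ x ⟧ ≋ x
  ⟦⟧≋ x = ≋-trans (mod≡ (cong (_% N) (toℕ-⟦⟧ x))) (≋-% x)

  ≋⇒≡ : ∀ {v w : Fin N} → toℕ v ≋ toℕ w → v ≡ w
  ≋⇒≡ {v} {w} (mod≡ e) =
    toℕ-injective (trans (sym (m<n⇒m%n≡m (toℕ<n v))) (trans e (m<n⇒m%n≡m (toℕ<n w))))

  -- The rotation `w ↦ w + 1` and the reflection `w ↦ 2a − w` fixing `a`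
  -- (written with `N − 1 = q + 2` in place of `−1`).
  next : Fin N → Fin N
  next w = ⟦ suc (toℕ w) ⟧

  reflect : Fin N → Fin N → Fin N
  reflect a w = ⟦ 2 * toℕ a + suc (suc q) * toℕ w ⟧

  next≋ : ∀ w → toℕ (next w) ≋ suc (toℕ w)
  next≋ w = ⟦⟧≋ (suc (toℕ w))

  reflect≋ : ∀ a w → toℕ (reflect a w) ≋ 2 * toℕ a + suc (suc q) * toℕ w
  reflect≋ a w = ⟦⟧≋ (2 * toℕ a + suc (suc q) * toℕ w)

  next-injective : ∀ {v w} → next v ≡ next w → v ≡ w
  next-injective {v} {w} e = ≋⇒≡ (≋-cancelʳ 1 (begin
    toℕ v + 1       ≡⟨ +-comm (toℕ v) 1 ⟩
    suc (toℕ v)     ≈⟨ next≋ v ⟨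
    toℕ (next v)    ≡⟨ cong toℕ e ⟩
    toℕ (next w)    ≈⟨ next≋ w ⟩
    suc (toℕ w)     ≡⟨ +-comm 1 (toℕ w) ⟩
    toℕ w + 1       ∎))

  -- Since `N ≥ 3`, two steps never return to the start.
  next²≢id : ∀ w → next (next w) ≢ w
  next²≢id w e = 2≉0 (≋-cancelʳ (toℕ w) (begin
    2 + toℕ w               ≈⟨ ≋-+ (≋-refl {1}) (next≋ w) ⟨
    suc (toℕ (next w))      ≈⟨ next≋ (next w) ⟨
    toℕ (next (next w))     ≡⟨ cong toℕ e ⟩
    toℕ w                   ∎))
    where
    2≉0 : ¬ 2 ≋ 0
    2≉0 (mod≡ 2≋0) with trans (sym (m<n⇒m%n≡m {n = N} (s≤s (s≤s (s≤s z≤n))))) 2≋0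
    ... | ()

  next-reflect : ∀ a w → next (reflect a (next w)) ≡ reflect a w
  next-reflect a w = ≋⇒≡ (begin
    toℕ (next (reflect a (next w)))  ≈⟨ next≋ (reflect a (next w)) ⟩
    suc (toℕ (reflect a (next w)))   ≈⟨ ≋-+ (≋-refl {1}) (reflect≋ a (next w)) ⟩
    suc (A + M * toℕ (next w))       ≈⟨ ≋-+ (≋-refl {suc A}) (≋-* (≋-refl {M}) (next≋ w)) ⟩
    suc (A + M * suc x)              ≡⟨ unfold A q x ⟩
    A + M * x + 1 * N                ≈⟨ ≋-multiple (A + M * x) 1 ⟩
    A + M * x                        ≈⟨ reflect≋ a w ⟨
    toℕ (reflect a w)                ∎)
    where
    A = 2 * toℕ a
    M = suc (suc q)
    x = toℕ w
    unfold : ∀ A q x → suc (A + suc (suc q) * suc x) ≡ A + suc (suc q) * x + 1 * suc (suc (suc q))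
    unfold = solve-∀

  reflect-involutive : ∀ a w → reflect a (reflect a w) ≡ w
  reflect-involutive a w = ≋⇒≡ (begin
    toℕ (reflect a (reflect a w))    ≈⟨ reflect≋ a (reflect a w) ⟩
    A + M * toℕ (reflect a w)        ≈⟨ ≋-+ (≋-refl {A}) (≋-* (≋-refl {M}) (reflect≋ a w)) ⟩
    A + M * (A + M * x)              ≡⟨ unfold A q x ⟩
    x + (A + suc q * x) * N          ≈⟨ ≋-multiple x (A + suc q * x) ⟩
    x                                ∎)
    where
    A = 2 * toℕ a
    M = suc (suc q)
    x = toℕ w
    unfold : ∀ A q x → A + suc (suc q) * (A + suc (suc q) * x) ≡ x + (A + suc q * x) * suc (suc (suc q))
    unfold = solve-∀

  reflect-fixes : ∀ a → reflect a a ≡ a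
  reflect-fixes a = ≋⇒≡ (begin
    toℕ (reflect a a)               ≈⟨ reflect≋ a a ⟩
    2 * toℕ a + suc (suc q) * toℕ a ≡⟨ unfold (toℕ a) q ⟩
    toℕ a + toℕ a * N               ≈⟨ ≋-multiple (toℕ a) (toℕ a) ⟩
    toℕ a                           ∎)
    where
    unfold : ∀ y q → 2 * y + suc (suc q) * y ≡ y + y * suc (suc (suc q))
    unfold = solve-∀

  reflect-fixed : ∀ h → h * 2 ≋ 1 → ∀ a w → reflect a w ≡ w → w ≡ a
  reflect-fixed h h*2≋1 a w e = ≋⇒≡ (begin
    x                      ≡⟨ *-identityˡ x ⟨
    1 * x                  ≈⟨ ≋-* h*2≋1 ≋-refl ⟨
    h * 2 * x              ≡⟨ *-assoc h 2 x ⟩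
    h * (2 * x)            ≈⟨ ≋-* (≋-refl {h}) 2x≋2a ⟩
    h * (2 * y)            ≡⟨ *-assoc h 2 y ⟨
    h * 2 * y              ≈⟨ ≋-* h*2≋1 ≋-refl ⟩
    1 * y                  ≡⟨ *-identityˡ y ⟩
    y                      ∎)
    where
    x = toℕ w
    y = toℕ a
    2x≋2a : 2 * x ≋ 2 * y
    2x≋2a = ≋-sym (begin
      2 * y                        ≈⟨ ≋-multiple (2 * y) x ⟨
      2 * y + x * N                ≡⟨ regroup y x q ⟩
      2 * y + suc (suc q) * x + x  ≈⟨ ≋-+ (reflect≋ a w) (≋-refl {x}) ⟨
      toℕ (reflect a w) + x        ≡⟨ cong (λ v → toℕ v + x) e ⟩
      x + x                        ≡⟨ cong (x +_) (+-identityʳ x) ⟨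
      2 * x                        ∎)
      where
      regroup : ∀ y x q → 2 * y + x * suc (suc (suc q)) ≡ 2 * y + suc (suc q) * x + x
      regroup = solve-∀

  Succ⇒next : ∀ {u v} → Succ N u v → v ≡ next u
  Succ⇒next {u} {v} s = ≋⇒≡ (≋-trans (successor≋ s) (≋-sym (next≋ u)))
    where
    successor≋ : Succ N u v → toℕ v ≋ suc (toℕ u)
    successor≋ (inj₁ v≡) = mod≡ (cong (_% N) v≡)
    successor≋ (inj₂ (u≡ , v≡)) = begin
      toℕ v         ≡⟨ v≡ ⟩
      0             ≈⟨ ≋-multiple 0 1 ⟨
      0 + 1 * N     ≡⟨ +-identityʳ N ⟩
      N             ≡⟨ cong suc u≡ ⟨
      suc (toℕ u)   ∎

  next-Succ : ∀ u → Succ N u (next u)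
  next-Succ u with suc (toℕ u) <? N
  ... | yes u+1<N = inj₁ (trans (toℕ-⟦⟧ (suc (toℕ u))) (m<n⇒m%n≡m u+1<N))
  ... | no  u+1≮N =
    inj₂ (u≡ , trans (toℕ-⟦⟧ (suc (toℕ u))) (trans (cong (λ t → suc t % N) u≡) (n%n≡0 N)))
    where
    u≡ : toℕ u ≡ N ∸ 1
    u≡ = ≤-antisym (≤-pred (toℕ<n u)) (≤-pred (≮⇒≥ u+1≮N))

  adjacent⇒ : ∀ {u v} → CycleAdj N u v → v ≡ next u ⊎ u ≡ next v
  adjacent⇒ (inj₁ s) = inj₁ (Succ⇒next s)
  adjacent⇒ (inj₂ s) = inj₂ (Succ⇒next s)

  ⇒adjacent : ∀ {u v} → v ≡ next u → CycleAdj N u v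
  ⇒adjacent {u} refl = inj₁ (next-Succ u)

  CycleAdj-sym : ∀ {x y} → CycleAdj N x y → CycleAdj N y x
  CycleAdj-sym (inj₁ s) = inj₂ s
  CycleAdj-sym (inj₂ s) = inj₁ s

  reflection : Fin N → Permutation′ N
  reflection a = permutation (reflect a) (reflect a) (reflect-involutive a) (reflect-involutive a)

  reflect-adjacent : ∀ a {u v} → CycleAdj N u v → CycleAdj N (reflect a u) (reflect a v)
  reflect-adjacent a {u} {v} adj with adjacent⇒ adj
  ... | inj₁ refl = CycleAdj-sym (⇒adjacent (sym (next-reflect a u)))
  ... | inj₂ refl = ⇒adjacent (sym (next-reflect a v))

  reflection-automorphism : ∀ a → IsAutomorphism N (reflection a)
  reflection-automorphism a u v = reflect-adjacent a , λ adj →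
    subst₂ (CycleAdj N) (reflect-involutive a u) (reflect-involutive a v) (reflect-adjacent a adj)

  reflect-moves : ∀ a → reflect a (next a) ≢ next a
  reflect-moves a e = next²≢id a (trans (cong next (sym e)) (trans (next-reflect a a) (reflect-fixes a)))

  cycle-induction : ∀ {P : Fin N → Set} a → P a → (∀ w → P w → P (next w)) → ∀ w → P w
  cycle-induction {P} a Pa step w = subst P (≋⇒≡ reaches-w) (walk (toℕ w + suc (suc q) * toℕ a))
    where
    iterate : ℕ → Fin N
    iterate zero    = a
    iterate (suc j) = next (iterate j)

    walk : ∀ j → P (iterate j)
    walk zero    = Pa
    walk (suc j) = step (iterate j) (walk j)

    iterate≋ : ∀ j → toℕ (iterate j) ≋ toℕ a + j
    iterate≋ zero    = mod≡ (cong (_% N) (sym (+-identityʳ (toℕ a))))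
    iterate≋ (suc j) = begin
      toℕ (next (iterate j))  ≈⟨ next≋ (iterate j) ⟩
      suc (toℕ (iterate j))   ≈⟨ ≋-+ (≋-refl {1}) (iterate≋ j) ⟩
      suc (toℕ a + j)         ≡⟨ +-suc (toℕ a) j ⟨
      toℕ a + suc j           ∎

    reaches-w : toℕ (iterate (toℕ w + suc (suc q) * toℕ a)) ≋ toℕ w
    reaches-w = begin
      toℕ (iterate (toℕ w + suc (suc q) * toℕ a)) ≈⟨ iterate≋ _ ⟩
      toℕ a + (toℕ w + suc (suc q) * toℕ a)       ≡⟨ regroup (toℕ a) (toℕ w) q ⟩
      toℕ w + toℕ a * N                           ≈⟨ ≋-multiple (toℕ w) (toℕ a) ⟩
      toℕ w                                       ∎
      where
      regroup : ∀ a w q → a + (w + suc (suc q) * a) ≡ w + a * suc (suc (suc q))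
      regroup = solve-∀

  -- An automorphism `σ` either turns the edge `{w , next w}` forwards or
  -- backwards, and does the same on the next edge; so it is a rotation or a
  -- reflection.
  module Automorphism (σ : Permutation′ N) (σ-aut : IsAutomorphism N σ) where

    f : Fin N → Fin N
    f = σ ⟨$⟩ʳ_

    f-injective : ∀ {x y} → f x ≡ f y → x ≡ y
    f-injective e = trans (sym (inverseˡ σ)) (trans (cong (σ ⟨$⟩ˡ_) e) (inverseˡ σ))

    Forwards Backwards : Fin N → Set
    Forwards  w = f (next w) ≡ next (f w)
    Backwards w = f w ≡ next (f (next w))

    forwards-or-backwards : ∀ w → Forwards w ⊎ Backwards w
    forwards-or-backwards w = adjacent⇒ (proj₁ (σ-aut w (next w)) (⇒adjacent refl))

    forwards-next : ∀ w → Forwards w → Forwards (next w)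
    forwards-next w fw with forwards-or-backwards (next w)
    ... | inj₁ fw' = fw'
    ... | inj₂ bw' = ⊥-elim (next²≢id w (sym (f-injective (next-injective (trans (sym fw) bw')))))

    backwards-next : ∀ w → Backwards w → Backwards (next w)
    backwards-next w bw with forwards-or-backwards (next w)
    ... | inj₁ fw' = ⊥-elim (next²≢id w (f-injective (trans fw' (sym bw))))
    ... | inj₂ bw' = bw'

    fixes-two⇒identity : ∀ h → h * 2 ≋ 1 → ∀ {a b} → a ≢ b → f a ≡ a → f b ≡ b → ∀ w → f w ≡ w
    fixes-two⇒identity h h*2≋1 {a} {b} a≢b fa fb with forwards-or-backwards a
    ... | inj₁ fw = cycle-induction a fa (λ w fw≡w → trans (forwards w) (cong next fw≡w))
      where
      forwards : ∀ w → Forwards w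
      forwards = cycle-induction a fw forwards-next
    ... | inj₂ bw = ⊥-elim (a≢b (sym (reflect-fixed h h*2≋1 a b (trans (sym (f≡reflect b)) fb))))
      where
      backwards : ∀ w → Backwards w
      backwards = cycle-induction a bw backwards-next
      f≡reflect : ∀ w → f w ≡ reflect a w
      f≡reflect = cycle-induction a (trans fa (sym (reflect-fixes a))) λ w fw≡ →
        next-injective (trans (sym (backwards w)) (trans fw≡ (sym (next-reflect a w))))

  two⇒fixing : ∀ h → h * 2 ≋ 1 → ∀ {F : Fin N → Set} {a b} → a ≢ b → F a → F b → IsFixingSet N F
  two⇒fixing h h*2≋1 a≢b Fa Fb σ σ-aut fixed =
    Automorphism.fixes-two⇒identity σ σ-aut h h*2≋1 a≢b (fixed _ Fa) (fixed _ Fb)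

  -- ... and a decidable fixing set must contain two: otherwise the
  -- reflection through its only element would fix it.
  fixing⇒two : ∀ {F : Fin N → Set} → Decidable F → IsFixingSet N F → ∀ {a} → F a → ∃ λ b → a ≢ b × F b
  fixing⇒two {F} F? F-fixing {a} Fa with any? (λ y → F? (punchIn a y))
  ... | yes (y , Fy) = punchIn a y , (λ e → punchInᵢ≢i a y (sym e)) , Fy
  ... | no  ¬other   = ⊥-elim (reflect-moves a (F-fixing (reflection a) (reflection-automorphism a) fixes-F (next a)))
    where
    fixes-F : ∀ v → F v → reflect a v ≡ v
    fixes-F v Fv with a ≟ v
    ... | yes refl = reflect-fixes a
    ... | no  a≢v  = ⊥-elim (¬other (punchOut a≢v , subst F (sym (punchIn-punchOut a≢v)) Fv))

  fixatic⇒AtLeastTwo : ∀ {k} (c : Vec (Fin k) N) → IsFixaticPartition N k c → AtLeastTwo (lookup c)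
  fixatic⇒AtLeastTwo c (onto , fixing) j with onto j
  ... | a , ca with fixing⇒two (λ v → lookup c v ≟ j) (fixing j) ca
  ...   | b , a≢b , cb = two a b a≢b ca cb

  AtLeastTwo⇒fixatic : ∀ h → h * 2 ≋ 1 → ∀ {k} (c : Vec (Fin k) N) →
    AtLeastTwo (lookup c) → IsFixaticPartition N k c
  AtLeastTwo⇒fixatic h h*2≋1 c c-two =
    (λ j → fst (c-two j) , fst∈ (c-two j)) ,
    (λ j → two⇒fixing h h*2≋1 (distinct (c-two j)) (fst∈ (c-two j)) (snd∈ (c-two j)))

consecutivePairs : ∀ k → Fin (double k) → Fin k
consecutivePairs zero    = λ ()
consecutivePairs (suc k) = pairWith zero (consecutivePairs k)

consecutivePairs-AtLeastTwo : ∀ k → AtLeastTwo (consecutivePairs k)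
consecutivePairs-AtLeastTwo zero    = λ ()
consecutivePairs-AtLeastTwo (suc k) = pairWith-AtLeastTwo zero (consecutivePairs-AtLeastTwo k)

half-bound : ∀ k m → k + k ≤ suc (double m) → k ≤ m
half-bound zero    m       _        = z≤n
half-bound (suc k) zero    (s≤s le) = ⊥-elim (n≮0 (subst (_≤ 0) (+-suc k k) le))
half-bound (suc k) (suc m) (s≤s le) = s≤s (half-bound k m (≤-pred (subst (_≤ suc (suc (double m))) (+-suc k k) le)))

module OddCycle (m : ℕ) where

  open Cycle (double m)

  half-inverse : suc (suc m) * 2 ≋ 1
  half-inverse = begin
    suc (suc m) * 2                 ≡⟨ regroup m ⟩
    1 + 1 * suc (suc (suc (m + m))) ≡⟨ cong (λ d → 1 + 1 * suc (suc (suc d))) (double≡+ m) ⟨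
    1 + 1 * N                       ≈⟨ ≋-multiple 1 1 ⟩
    1                               ∎
    where
    open import Relation.Binary.Reasoning.Setoid ≋-setoid
    regroup : ∀ m → suc (suc m) * 2 ≡ 1 + 1 * suc (suc (suc (m + m)))
    regroup = solve-∀

  fixatic-number : IsFixaticNumber N (suc m)
  fixatic-number = (tabulate example , example-fixatic) , at-most
    where
    example : Fin N → Fin (suc m)
    example = extend (consecutivePairs (suc m)) zero
    example-AtLeastTwo : AtLeastTwo (lookup (tabulate example))
    example-AtLeastTwo = AtLeastTwo-resp-≗ (sym ∘ lookup∘tabulate example)
      (extend-AtLeastTwo zero (consecutivePairs-AtLeastTwo (suc m)))
    example-fixatic : IsFixaticPartition N (suc m) (tabulate example)
    example-fixatic = AtLeastTwo⇒fixatic (suc (suc m)) half-inverse (tabulate example) example-AtLeastTwo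
    at-most : ∀ k (c : Vec (Fin k) N) → IsFixaticPartition N k c → k ≤ suc m
    at-most k c c-fixatic = half-bound k (suc m) (class-bound (lookup c) (fixatic⇒AtLeastTwo c c-fixatic))

  fixatic-count : NumFixaticPartitions N (suc m) (tripleCount (suc m))
  fixatic-count = map tabulate L , length-≡ , all-fixatic , distinct-partitions , complete
    where
    L = pairingsWithTriple (suc m)
    tab≗ : ∀ g → lookup (tabulate g) ≗ g
    tab≗ = lookup∘tabulate
    length-≡ : length (map tabulate L) ≡ tripleCount (suc m)
    length-≡ = trans (length-map tabulate L) (length-pairingsWithTriple (suc m))
    all-fixatic : All (IsFixaticPartition N (suc m)) (map tabulate L)
    all-fixatic = All.map⁺ (All.map (λ {g} g-two →
      AtLeastTwo⇒fixatic (suc (suc m)) half-inverse (tabulate g) (AtLeastTwo-resp-≗ (sym ∘ tab≗ g) g-two))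
      (pairingsWithTriple-AtLeastTwo (suc m)))
    distinct-partitions : AllPairs (λ c d → ¬ SamePartition c d) (map tabulate L)
    distinct-partitions = AllPairs.map⁺ (AllPairs.map
      (λ {f} {g} f≉g same → f≉g (≈-resp-≗ (tab≗ f) (tab≗ g) same)) (pairingsWithTriple-distinct (suc m)))
    complete : ∀ c → IsFixaticPartition N (suc m) c → Any (SamePartition c) (map tabulate L)
    complete c c-fixatic = Any.map⁺ (Any.map (λ {g} c≈g → ≈-resp-≗ (λ _ → refl) (sym ∘ tab≗ g) c≈g)
      (pairingsWithTriple-complete (suc m) (lookup c) (fixatic⇒AtLeastTwo c c-fixatic)))

even-or-odd : ∀ n → (∃ λ m → n ≡ double m) ⊎ (∃ λ m → n ≡ suc (double m))
even-or-odd zero = inj₁ (0 , refl)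
even-or-odd (suc n) with even-or-odd n
... | inj₁ (m , refl) = inj₂ (m , refl)
... | inj₂ (m , refl) = inj₁ (suc m , refl)

double-even : ∀ m → 2 ∣ double m
double-even m = divides m (trans (double≡+ m) (m+m≡m*2 m))
  where
  m+m≡m*2 : ∀ m → m + m ≡ m * 2
  m+m≡m*2 = solve-∀

half-of-odd : ∀ m → suc (double m) / 2 ≡ m
half-of-odd zero    = refl
half-of-odd (suc m) = trans (m/n≡1+[m∸n]/n {suc (double (suc m))} {2} (s≤s (s≤s z≤n))) (cong suc (half-of-odd m))

mainTheorem6 : (n : ℕ) → 3 ≤ n → ¬ (2 ∣ n) →
    IsFixaticNumber n (n / 2) ×
    NumFixaticPartitions n (n / 2)
      (_/_ ((n C 3) * multinomial (n ∸ 3) (replicate (n / 2 ∸ 1) 2))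
           ((n / 2 ∸ 1) !) {{(n / 2 ∸ 1) !≢0}})
mainTheorem6 (suc (suc (suc n))) (s≤s (s≤s (s≤s z≤n))) n-odd with even-or-odd n
... | inj₂ (m , refl) = ⊥-elim (n-odd (double-even (suc (suc m))))
... | inj₁ (m , refl) rewrite half-of-odd (suc m) =
  fixatic-number , subst (NumFixaticPartitions _ (suc m)) (sym (count-formula m)) fixatic-count
  where open OddCycle m
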